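{- Let $G^u=(\mathcal{T},E,p,h)$ be a well-formed uniform graph with binary heights (all heights in $\{0,1\}$) that contains all redundant restrictions. Then the max-plus matrix $A$ associated with $G^u$ is irreducible.
   Context: A uniform graph $G^u=(\mathcal{T},E,p,h)$ consists of a finite directed multigraph $(\mathcal{T},E)$ (nodes are tasks), a weight function $p:E\to\mathbb{N}^*$ and a height function $h:E\to\mathbb{N}$, such that all edges entering a node $j$ have the same weight $P_j$; an edge from $i$ to $j$ of height $h_R$ represents the restriction $t(i,n)\ge t(j,n-h_R)+P_j$ for all $n\ge h_R$. $G^u$ is well-formed if $(\mathcal{T},E)$ is strongly connected and contains no nonempty closed walk whose edges have total height $0$. $G^u$ contains all redundant restrictions if for every edge from $i$ to $j$ there is also an edge from $i$ to $j$ of height $1$ (and weight $P_j$). For binary heights, the associated $\mathcal{T}\times\mathcal{T}$ max-plus matrix $A$ is defined by: $A_{i,j}$ is the maximum total weight of a nonempty walk from $i$ to $j$ in $G^u$ all of whose edges have height $0$ except the last one, which has height $1$; $A_{i,j}=-\infty$ if no such walk exists. $A$ is irreducible if the directed graph on $\mathcal{T}$ with an edge $(i,j)$ iff $A_{i,j}\ne-\infty$ is strongly connected. -}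

module Defs where

open import Data.Nat using (ℕ; zero; suc; _+_; _≤_; NonZero)
open import Data.Fin using (Fin)
open import Data.Product using (Σ; _×_; ∃-syntax)
open import Data.Empty using (⊥)
open import Data.Unit using (⊤)
open import Relation.Binary.PropositionalEquality using (_≡_)
open import Relation.Binary.Construct.Closure.ReflexiveTransitive using (Star)

record UniformGraph (n : ℕ) : Set where
  field
    m        : ℕ
    src tgt  : Fin m → Fin n
    p h      : Fin m → ℕ
    p-pos    : ∀ e → NonZero (p e)
    p-enter  : ∀ e e′ → tgt e ≡ tgt e′ → p e ≡ p e′

module _ {n : ℕ} (G : UniformGraph n) where
  open UniformGraph G

  data Walk : Fin n → Fin n → Set where
    []  : ∀ {i} → Walk i i
    cons : ∀ {i j} (e : Fin m) → src e ≡ i → Walk (tgt e) j → Walk i j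

  Nonempty : ∀ {i j} → Walk i j → Set
  Nonempty []           = ⊥
  Nonempty (cons _ _ _) = ⊤

  totalHeight : ∀ {i j} → Walk i j → ℕ
  totalHeight []            = 0
  totalHeight (cons e _ w)  = h e + totalHeight w

  totalWeight : ∀ {i j} → Walk i j → ℕ
  totalWeight []            = 0
  totalWeight (cons e _ w)  = p e + totalWeight w

  EdgeRel : Fin n → Fin n → Set
  EdgeRel i j = Σ (Fin m) λ e → src e ≡ i × tgt e ≡ j

  StronglyConnected : Set
  StronglyConnected = ∀ i j → Star EdgeRel i j

  WellFormed : Set
  WellFormed = StronglyConnected
             × (∀ i (w : Walk i i) → Nonempty w → totalHeight w ≡ 0 → ⊥)

  BinaryHeights : Set
  BinaryHeights = ∀ e → h e ≤ 1

  AllRedundant : Set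
  AllRedundant = ∀ e → ∃[ e′ ] (src e′ ≡ src e × tgt e′ ≡ tgt e × h e′ ≡ 1 × p e′ ≡ p e)

  ZeroThenOne : ∀ {i j} → Walk i j → Set
  ZeroThenOne []                     = ⊥
  ZeroThenOne (cons e _ [])          = h e ≡ 1
  ZeroThenOne (cons e _ w@(cons _ _ _)) = h e ≡ 0 × ZeroThenOne w

  -- A_{i,j} is the max of totalWeight w over walks w from i to j with ZeroThenOne w,
  -- and A_{i,j} = -∞ iff no such walk exists.  Hence A_{i,j} ≠ -∞ iff:
  A-finite : Fin n → Fin n → Set
  A-finite i j = Σ (Walk i j) ZeroThenOne

  A-Irreducible : Set
  A-Irreducible = ∀ i j → Star A-finite i j

-- A has a finite entry wherever (𝒯, E) has an edge: the redundant copy of that edge,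
-- of height 1 and weight P_j, is by itself a walk of the required shape. So the digraph
-- of A contains (𝒯, E) and inherits its strong connectivity.
module Submission where

open import Defs
open import Data.Nat using (ℕ)
open import Data.Product using (_,_)
open import Relation.Binary.PropositionalEquality using (_≡_; refl; subst₂)
open import Relation.Binary.Construct.Closure.ReflexiveTransitive using (map)

module _ {n : ℕ} (G : UniformGraph n) where
  open UniformGraph G

  A-finite-height-one-edge : ∀ e → h e ≡ 1 → A-finite G (src e) (tgt e)
  A-finite-height-one-edge e h≡1 = cons e refl [] , h≡1

  EdgeRel⇒A-finite : AllRedundant G → ∀ {i j} → EdgeRel G i j → A-finite G i j
  EdgeRel⇒A-finite red (e , refl , refl) with red e
  ... | e′ , src≡ , tgt≡ , h≡1 , _ =
    subst₂ (A-finite G) src≡ tgt≡ (A-finite-height-one-edge e′ h≡1)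

  StronglyConnected⇒A-Irreducible : AllRedundant G → StronglyConnected G → A-Irreducible G
  StronglyConnected⇒A-Irreducible red sc i j = map (EdgeRel⇒A-finite red) (sc i j)

proposition8 : ∀ {n : ℕ} (G : UniformGraph n) → WellFormed G → BinaryHeights G → AllRedundant G → A-Irreducible G
proposition8 G (sc , _) _ red = StronglyConnected⇒A-Irreducible G red sc
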